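{- Let $p$ be an odd prime and let $x$ be an integer with $f_p(x)\equiv0\pmod p$. Then $f_p(-x-1)\equiv0\pmod p$. Furthermore, if $p\nmid x$, then $f_p(x^{ -1})\equiv0\pmod p$, where $x^{ -1}$ is any integer with $xx^{ -1}\equiv1\pmod p$.
   Context: For a prime $p$, $f_p(x)=\frac{(x+1)^p-x^p-1}{p}\in\mathbb Z[x]$. -}

module Defs where

open import Data.Nat using (ℕ; NonZero)
open import Data.Integer using (ℤ; +_; _+_; _-_; _^_; 1ℤ)
open import Data.Integer.DivMod using (_/ℕ_)

-- f_p(x) = ((x+1)^p - x^p - 1) / p  (exact division in ℤ; the numerator is
-- divisible by p for prime p, so this is the integer polynomial value).
f : (p : ℕ) .{{_ : NonZero p}} → ℤ → ℤ
f p x = (((x + 1ℤ) ^ p) - (x ^ p) - 1ℤ) /ℕ p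

-- Write N(x) = (x+1)^p - x^p - 1, so that f_p(x) = N(x)/p; the middle binomial
-- coefficients are divisible by p, hence so is N(x). For odd p, (-a)^p = -a^p gives
-- N(-x-1) = N(x). If xy ≡ 1 (mod p), put e = xy - 1; then
--   x^p N(y) = ((x+1) + e)^p - (1 + e)^p - x^p,
-- and since p ∣ e we have (a + e)^p ≡ a^p (mod p²), so x^p N(y) ≡ N(x) ≡ 0 (mod p²).
-- Thus p ∣ x^p f_p(y), and p ∤ x forces p ∣ f_p(y).
module Submission where

open import Defs
open import Data.Nat as ℕ using (ℕ; zero; suc; _!; z≤n; s≤s; NonZero)
import Data.Nat.Properties as ℕ
import Data.Nat.Divisibility as ℕ
open import Data.Nat.DivMod using (m/n*n≡m; m≡m%n+[m/n]*n; m%n<n)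
open import Data.Nat.Primality
  using (Prime; prime⇒nonTrivial; prime⇒nonZero; prime⇒¬composite; composite-≢; euclidsLemma)
open import Data.Nat.Combinatorics using (_C_; nCn≡1; k![n∸k]!∣n!; nCk≡n!/k![n-k]!)
open import Data.Integer
  using (ℤ; +_; _+_; _-_; _*_; -_; _^_; _/ℕ_; ∣_∣; 0ℤ; 1ℤ; _≤_)
  renaming (suc to sucℤ)
open import Data.Integer.Properties
  using (*-zeroˡ; *-identityˡ; *-identityʳ; +-identityʳ; *-assoc; suc-*; neg-distribˡ-*; abs-*;
         ^-zeroˡ; ^-*-assoc; ≤-antisym; *-cancelʳ-≤-pos; *-cancelʳ-<-nonNeg;
         i<j⇒i≤pred[j]; pred-suc; +-*-commutativeSemiring; +-0-monoid)
open import Data.Integer.DivMod using ([n/ℕd]*d≤n; n<s[n/ℕd]*d)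
open import Data.Integer.Divisibility using (_∣_)
open import Data.Integer.Divisibility.Signed as Signed
  using (divides; ∣ᵤ⇒∣; ∣⇒∣ᵤ; ∣m∣n⇒∣m+n; ∣m∣n⇒∣m-n; ∣m⇒∣m*n)
  renaming (_∣_ to _∣ₛ_)
open import Data.Integer.Tactic.RingSolver using (solve-∀)
open import Data.Fin as Fin using (toℕ; inject₁)
open import Data.Fin.Properties using (toℕ-fromℕ; toℕ-inject₁; toℕ<n)
open import Data.Vec.Functional using (Vector; init; last; tail)
open import Data.Product using (_×_; _,_; ∃-syntax)
open import Data.Sum using (inj₁; inj₂)
open import Function using (_∘_)
open import Relation.Nullary using (¬_; contradiction)
open import Relation.Binary.PropositionalEquality
open import Algebra.Properties.CommutativeSemiring.Binomial +-*-commutativeSemiring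
  using (binomialTerm; theorem)
open import Algebra.Properties.CommutativeSemiring.Exp +-*-commutativeSemiring
  using (^-distrib-*) renaming (_^_ to _^ᵐ_)
open import Algebra.Properties.Monoid.Sum +-0-monoid using (sum; sum-init-last)
open import Algebra.Properties.Monoid.Mult +-0-monoid using () renaming (_×_ to _×ᵐ_)

prime∤! : ∀ {p} → Prime p → ∀ {n} → n ℕ.< p → p ℕ.∤ n !
prime∤! pr {zero}  _   p∣1 = ℕ.nonTrivial⇒≢1 {{prime⇒nonTrivial pr}} (ℕ.∣1⇒≡1 p∣1)
prime∤! pr {suc n} n<p p∣[1+n]! with euclidsLemma (suc n) (n !) pr p∣[1+n]!
... | inj₁ p∣1+n = ℕ.<⇒≱ n<p (ℕ.∣⇒≤ p∣1+n)
... | inj₂ p∣n!  = prime∤! pr (ℕ.<-trans (ℕ.n<1+n n) n<p) p∣n!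

nCk*k![n∸k]!≡n! : ∀ {n k} → k ℕ.≤ n → (n C k) ℕ.* (k ! ℕ.* (n ℕ.∸ k) !) ≡ n !
nCk*k![n∸k]!≡n! {n} {k} k≤n =
  trans (cong (ℕ._* (k ! ℕ.* (n ℕ.∸ k) !)) (nCk≡n!/k![n-k]! k≤n)) (m/n*n≡m (k![n∸k]!∣n! k≤n))
  where instance _ = k ℕ.!* (n ℕ.∸ k) !≢0

prime∣pCk : ∀ {p k} → Prime p → 0 ℕ.< k → k ℕ.< p → p ℕ.∣ p C k
prime∣pCk {p@(suc m)} {k@(suc j)} pr _ k<p
  with euclidsLemma (p C k) (k ! ℕ.* (p ℕ.∸ k) !) pr
         (subst (p ℕ.∣_) (sym (nCk*k![n∸k]!≡n! (ℕ.<⇒≤ k<p))) (ℕ.m∣m*n (m !)))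
... | inj₁ p∣pCk = p∣pCk
... | inj₂ p∣k![p∸k]! with euclidsLemma (k !) ((p ℕ.∸ k) !) pr p∣k![p∸k]!
...   | inj₁ p∣k!     = contradiction p∣k! (prime∤! pr k<p)
...   | inj₂ p∣[p∸k]! = contradiction p∣[p∸k]! (prime∤! pr (s≤s (ℕ.m∸n≤m m j)))

-- The binomial theorem of the algebra library uses the generic power and
-- multiple of a semiring, which agree with those of ℤ only propositionally.
^ᵐ≡^ : ∀ i n → i ^ᵐ n ≡ i ^ n
^ᵐ≡^ i zero    = refl
^ᵐ≡^ i (suc n) = cong (i *_) (^ᵐ≡^ i n)

×ᵐ≡* : ∀ n i → n ×ᵐ i ≡ + n * i
×ᵐ≡* zero    i = sym (*-zeroˡ i)
×ᵐ≡* (suc n) i = trans (cong (λ j → i + j) (×ᵐ≡* n i)) (sym (suc-* (+ n) i))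

^-distribʳ-* : ∀ i j n → (i * j) ^ n ≡ i ^ n * j ^ n
^-distribʳ-* i j n =
  trans (sym (^ᵐ≡^ (i * j) n)) (trans (^-distrib-* i j n) (cong₂ _*_ (^ᵐ≡^ i n) (^ᵐ≡^ j n)))

∣-sum : ∀ {d n} (t : Vector ℤ n) → (∀ k → d ∣ₛ t k) → d ∣ₛ sum t
∣-sum {d} {zero}  t _    = divides 0ℤ (sym (*-zeroˡ d))
∣-sum {n = suc n} t d∣t = ∣m∣n⇒∣m+n (d∣t Fin.zero) (∣-sum (tail t) (d∣t ∘ Fin.suc))

prime∣[x+y]^p-x^p-y^p : ∀ {p} → Prime p → ∀ x y → + p ∣ₛ (x + y) ^ p - x ^ p - y ^ p
prime∣[x+y]^p-x^p-y^p {p@(suc m)} pr x y = subst (+ p ∣ₛ_) (sym expansion) (∣-sum middle p∣middle)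
  where
  t = binomialTerm x y p
  middle = init (tail t)

  p∣middle : ∀ k → + p ∣ₛ middle k
  p∣middle k = subst (+ p ∣ₛ_) (sym (×ᵐ≡* c _))
    (∣m⇒∣m*n {m = + c} _ (∣ᵤ⇒∣ (prime∣pCk pr (s≤s z≤n) (s≤s k<m))))
    where
    c = p C suc (toℕ (inject₁ k))
    k<m : toℕ (inject₁ k) ℕ.< m
    k<m = subst (ℕ._< m) (sym (toℕ-inject₁ k)) (toℕ<n k)

  first-term : t Fin.zero ≡ y ^ p
  first-term = trans (+-identityʳ _) (trans (*-identityˡ _) (^ᵐ≡^ y p))

  last-term : last (tail t) ≡ x ^ p
  last-term rewrite toℕ-fromℕ m | nCn≡1 p | ℕ.n∸n≡0 m =
    trans (+-identityʳ _) (trans (*-identityʳ _) (^ᵐ≡^ x p))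

  expansion : (x + y) ^ p - x ^ p - y ^ p ≡ sum middle
  expansion = begin
    (x + y) ^ p - x ^ p - y ^ p
      ≡⟨ cong (λ z → z - x ^ p - y ^ p) (trans (sym (^ᵐ≡^ (x + y) p)) (theorem p x y)) ⟩
    t Fin.zero + sum (tail t) - x ^ p - y ^ p
      ≡⟨ cong (λ z → t Fin.zero + z - x ^ p - y ^ p) (sum-init-last (tail t)) ⟩
    t Fin.zero + (sum middle + last (tail t)) - x ^ p - y ^ p
      ≡⟨ cong₂ (λ u v → u + (sum middle + v) - x ^ p - y ^ p) first-term last-term ⟩
    y ^ p + (sum middle + x ^ p) - x ^ p - y ^ p
      ≡⟨ cancel (y ^ p) (x ^ p) (sum middle) ⟩
    sum middle ∎
    where
    open ≡-Reasoning
    cancel : ∀ a b c → a + (c + b) - b - a ≡ c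
    cancel = solve-∀

i*n/ℕn≡i : ∀ i n .{{_ : NonZero n}} → (i * + n) /ℕ n ≡ i
i*n/ℕn≡i i n@(suc _) = ≤-antisym q≤i i≤q
  where
  q = (i * + n) /ℕ n
  q≤i : q ≤ i
  q≤i = *-cancelʳ-≤-pos q i (+ n) ([n/ℕd]*d≤n (i * + n) n)
  i≤q : i ≤ q
  i≤q = subst (i ≤_) (pred-suc q)
    (i<j⇒i≤pred[j] (*-cancelʳ-<-nonNeg {i} {sucℤ q} (+ n) (n<s[n/ℕd]*d (i * + n) n)))

numerator : ℕ → ℤ → ℤ
numerator n x = (x + 1ℤ) ^ n - x ^ n - 1ℤ

numerator≡f*p : ∀ {p} .{{_ : NonZero p}} → Prime p → ∀ x → numerator p x ≡ f p x * + p
numerator≡f*p {p} pr x with prime∣[x+y]^p-x^p-y^p pr x 1ℤ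
... | divides q eq = trans N≡q*p (cong (_* + p) (sym f≡q))
  where
  N≡q*p : numerator p x ≡ q * + p
  N≡q*p = trans (cong (λ z → (x + 1ℤ) ^ p - x ^ p - z) (sym (^-zeroˡ p))) eq
  f≡q : f p x ≡ q
  f≡q = trans (cong (_/ℕ p) N≡q*p) (i*n/ℕn≡i q p)

prime≢2⇒odd : ∀ {p} → Prime p → p ≢ 2 → ∃[ k ] p ≡ suc (2 ℕ.* k)
prime≢2⇒odd {p} pr p≢2 with p ℕ.% 2 | m≡m%n+[m/n]*n p 2 | m%n<n p 2
... | 0 | p≡[p/2]*2 | _ =
  contradiction (composite-≢ 2 {{_}} {{prime⇒nonZero pr}} (p≢2 ∘ sym) (ℕ.divides (p ℕ./ 2) p≡[p/2]*2))
                (prime⇒¬composite pr)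
... | 1 | p≡1+[p/2]*2 | _ = p ℕ./ 2 , trans p≡1+[p/2]*2 (cong suc (ℕ.*-comm (p ℕ./ 2) 2))
... | suc (suc _) | _ | s≤s (s≤s ())

[-i]^[2k]≡i^[2k] : ∀ i k → (- i) ^ (2 ℕ.* k) ≡ i ^ (2 ℕ.* k)
[-i]^[2k]≡i^[2k] i k = begin
  (- i) ^ (2 ℕ.* k)  ≡⟨ ^-*-assoc (- i) 2 k ⟨
  ((- i) ^ 2) ^ k    ≡⟨ cong (_^ k) (square-neg i) ⟩
  (i ^ 2) ^ k        ≡⟨ ^-*-assoc i 2 k ⟩
  i ^ (2 ℕ.* k)      ∎
  where
  open ≡-Reasoning
  square-neg : ∀ i → (- i) * ((- i) * 1ℤ) ≡ i * (i * 1ℤ)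
  square-neg = solve-∀

[-i]^[1+2k]≡-i^[1+2k] : ∀ i k → (- i) ^ suc (2 ℕ.* k) ≡ - (i ^ suc (2 ℕ.* k))
[-i]^[1+2k]≡-i^[1+2k] i k =
  trans (cong ((- i) *_) ([-i]^[2k]≡i^[2k] i k)) (sym (neg-distribˡ-* i (i ^ (2 ℕ.* k))))

numerator[-x-1]≡numerator[x] : ∀ k x → let n = suc (2 ℕ.* k) in
                               numerator n (- x - 1ℤ) ≡ numerator n x
numerator[-x-1]≡numerator[x] k x = begin
  (- x - 1ℤ + 1ℤ) ^ n - (- x - 1ℤ) ^ n - 1ℤ
    ≡⟨ cong₂ (λ u v → u ^ n - v ^ n - 1ℤ) (-x-1+1≡-x x) (-x-1≡-[x+1] x) ⟩
  (- x) ^ n - (- (x + 1ℤ)) ^ n - 1ℤ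
    ≡⟨ cong₂ (λ u v → u - v - 1ℤ) ([-i]^[1+2k]≡-i^[1+2k] x k) ([-i]^[1+2k]≡-i^[1+2k] (x + 1ℤ) k) ⟩
  - (x ^ n) - - ((x + 1ℤ) ^ n) - 1ℤ
    ≡⟨ swap ((x + 1ℤ) ^ n) (x ^ n) ⟩
  (x + 1ℤ) ^ n - x ^ n - 1ℤ ∎
  where
  n = suc (2 ℕ.* k)
  open ≡-Reasoning
  -x-1+1≡-x : ∀ x → - x - 1ℤ + 1ℤ ≡ - x
  -x-1+1≡-x = solve-∀
  -x-1≡-[x+1] : ∀ x → - x - 1ℤ ≡ - (x + 1ℤ)
  -x-1≡-[x+1] = solve-∀
  swap : ∀ a b → - b - - a - 1ℤ ≡ a - b - 1ℤ
  swap = solve-∀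

f[-x-1]≡f[x] : ∀ {p} .{{_ : NonZero p}} → Prime p → p ≢ 2 → ∀ x → f p (- x - 1ℤ) ≡ f p x
f[-x-1]≡f[x] {p} pr p≢2 x with prime≢2⇒odd pr p≢2
... | k , refl = cong (_/ℕ p) (numerator[-x-1]≡numerator[x] k x)

[a+d]^[1+n]-expansion : ∀ n a d → ∃[ c ] (a + d) ^ suc n ≡ a ^ suc n + + suc n * a ^ n * d + c * (d * d)
[a+d]^[1+n]-expansion zero    a d = 0ℤ , base a d
  where
  base : ∀ a d → (a + d) * 1ℤ ≡ a * 1ℤ + 1ℤ * 1ℤ * d + 0ℤ * (d * d)
  base = solve-∀
[a+d]^[1+n]-expansion (suc n) a d with [a+d]^[1+n]-expansion n a d
... | c , eq = a * c + + suc n * a ^ n + c * d , (begin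
  (a + d) * (a + d) ^ suc n
    ≡⟨ cong ((a + d) *_) eq ⟩
  (a + d) * (a * a ^ n + + suc n * a ^ n * d + c * (d * d))
    ≡⟨ step a d (a ^ n) (+ suc n) c ⟩
  a * (a * a ^ n) + (1ℤ + + suc n) * (a * a ^ n) * d + (a * c + + suc n * a ^ n + c * d) * (d * d) ∎)
  where
  open ≡-Reasoning
  step : ∀ a d A m c → (a + d) * (a * A + m * A * d + c * (d * d))
                     ≡ a * (a * A) + (1ℤ + m) * (a * A) * d + (a * c + m * A + c * d) * (d * d)
  step = solve-∀

m∣e⇒m*m∣[a+e]^m-a^m : ∀ m a {e} → + m ∣ₛ e → + m * + m ∣ₛ (a + e) ^ m - a ^ m
m∣e⇒m*m∣[a+e]^m-a^m zero    a _                = divides 0ℤ refl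
m∣e⇒m*m∣[a+e]^m-a^m (suc n) a (divides t refl) with [a+d]^[1+n]-expansion n a (t * + suc n)
... | c , eq = divides (a ^ n * t + c * t * t)
  (trans (cong (_- a ^ suc n) eq) (collect (a ^ suc n) (a ^ n) t c (+ suc n)))
  where
  collect : ∀ A B t c m → A + m * B * (t * m) + c * ((t * m) * (t * m)) - A
                        ≡ (B * t + c * t * t) * (m * m)
  collect = solve-∀

x^n*numerator[y] : ∀ n x y → let e = x * y - 1ℤ in
  x ^ n * numerator n y ≡ numerator n x + (((x + 1ℤ) + e) ^ n - (x + 1ℤ) ^ n) - ((1ℤ + e) ^ n - 1ℤ ^ n)
x^n*numerator[y] n x y = begin
  x ^ n * ((y + 1ℤ) ^ n - y ^ n - 1ℤ)
    ≡⟨ distrib (x ^ n) ((y + 1ℤ) ^ n) (y ^ n) ⟩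
  x ^ n * (y + 1ℤ) ^ n - x ^ n * y ^ n - x ^ n
    ≡⟨ cong₂ (λ u v → u - v - x ^ n) (^-distribʳ-* x (y + 1ℤ) n) (^-distribʳ-* x y n) ⟨
  (x * (y + 1ℤ)) ^ n - (x * y) ^ n - x ^ n
    ≡⟨ cong₂ (λ u v → u ^ n - v ^ n - x ^ n) (x[y+1]≡[x+1]+e x y) (xy≡1+e x y) ⟩
  ((x + 1ℤ) + e) ^ n - (1ℤ + e) ^ n - x ^ n
    ≡⟨ regroup (((x + 1ℤ) + e) ^ n) ((1ℤ + e) ^ n) (x ^ n) ((x + 1ℤ) ^ n) ⟩
  numerator n x + (((x + 1ℤ) + e) ^ n - (x + 1ℤ) ^ n) - ((1ℤ + e) ^ n - 1ℤ)
    ≡⟨ cong (λ o → numerator n x + (((x + 1ℤ) + e) ^ n - (x + 1ℤ) ^ n) - ((1ℤ + e) ^ n - o))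
            (^-zeroˡ n) ⟨
  numerator n x + (((x + 1ℤ) + e) ^ n - (x + 1ℤ) ^ n) - ((1ℤ + e) ^ n - 1ℤ ^ n) ∎
  where
  open ≡-Reasoning
  e = x * y - 1ℤ
  distrib : ∀ X A B → X * (A - B - 1ℤ) ≡ X * A - X * B - X
  distrib = solve-∀
  x[y+1]≡[x+1]+e : ∀ x y → x * (y + 1ℤ) ≡ (x + 1ℤ) + (x * y - 1ℤ)
  x[y+1]≡[x+1]+e = solve-∀
  xy≡1+e : ∀ x y → x * y ≡ 1ℤ + (x * y - 1ℤ)
  xy≡1+e = solve-∀
  regroup : ∀ P Q X A → P - Q - X ≡ (A - X - 1ℤ) + (P - A) - (Q - 1ℤ)
  regroup = solve-∀

prime∤i⇒∣i^n*j⇒∣j : ∀ {p} → Prime p → ∀ {i} → ¬ (+ p ∣ i) → ∀ n {j} → + p ∣ i ^ n * j → + p ∣ j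
prime∤i⇒∣i^n*j⇒∣j {p} pr p∤i zero {j} p∣1*j = subst (+ p ∣_) (*-identityˡ j) p∣1*j
prime∤i⇒∣i^n*j⇒∣j pr {i} p∤i (suc n) {j} p∣i*i^n*j
  with euclidsLemma ∣ i ∣ ∣ i ^ n * j ∣ pr
         (subst (_ ℕ.∣_) (trans (cong ∣_∣ (*-assoc i (i ^ n) j)) (abs-* i (i ^ n * j))) p∣i*i^n*j)
... | inj₁ p∣i     = contradiction p∣i p∤i
... | inj₂ p∣i^n*j = prime∤i⇒∣i^n*j⇒∣j pr p∤i n p∣i^n*j

p∣f[x]⇒p∣f[x⁻¹] : ∀ {p} .{{_ : NonZero p}} → Prime p → ∀ {x} → + p ∣ f p x → ¬ (+ p ∣ x) →
                  ∀ y → + p ∣ x * y - 1ℤ → + p ∣ f p y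
p∣f[x]⇒p∣f[x⁻¹] {p} pr {x} p∣fx p∤x y p∣xy-1 =
  prime∤i⇒∣i^n*j⇒∣j pr p∤x p (∣⇒∣ᵤ (Signed.*-cancelʳ-∣ (+ p) {+ p} {x ^ p * f p y} p*p∣x^p*fy*p))
  where
  p∣e : + p ∣ₛ x * y - 1ℤ
  p∣e = ∣ᵤ⇒∣ p∣xy-1
  p*p∣N[x] : + p * + p ∣ₛ numerator p x
  p*p∣N[x] = subst (+ p * + p ∣ₛ_) (sym (numerator≡f*p pr x))
    (Signed.*-monoˡ-∣ (+ p) {+ p} {f p x} (∣ᵤ⇒∣ p∣fx))
  p*p∣x^p*N[y] : + p * + p ∣ₛ x ^ p * numerator p y
  p*p∣x^p*N[y] = subst (+ p * + p ∣ₛ_) (sym (x^n*numerator[y] p x y))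
    (∣m∣n⇒∣m-n (∣m∣n⇒∣m+n p*p∣N[x] (m∣e⇒m*m∣[a+e]^m-a^m p (x + 1ℤ) p∣e))
               (m∣e⇒m*m∣[a+e]^m-a^m p 1ℤ p∣e))
  p*p∣x^p*fy*p : + p * + p ∣ₛ x ^ p * f p y * + p
  p*p∣x^p*fy*p = subst (+ p * + p ∣ₛ_)
    (trans (cong (x ^ p *_) (numerator≡f*p pr y)) (sym (*-assoc (x ^ p) (f p y) (+ p))))
    p*p∣x^p*N[y]

lemma5p1 : (p : ℕ) .{{_ : NonZero p}} → Prime p → p ≢ 2 → (x : ℤ) →
    (+ p) ∣ f p x →
    ((+ p) ∣ f p (- x - 1ℤ))
    × (¬ ((+ p) ∣ x) → (y : ℤ) → (+ p) ∣ ((x * y) - 1ℤ) → (+ p) ∣ f p y)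
lemma5p1 p pr p≢2 x p∣fx =
  subst (+ p ∣_) (sym (f[-x-1]≡f[x] pr p≢2 x)) p∣fx , p∣f[x]⇒p∣f[x⁻¹] pr p∣fx
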